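{- Let $\mathcal{S}=\{s_1,\ldots,s_n\}$ be a finite set of items, $\mathcal{L}=\{\ell_1,\ldots,\ell_k\}$ a set of qualitative levels totally ordered by $\ell_1\prec\cdots\prec\ell_k$, $w\colon\mathcal{S}\to\mathbb{N}$, $r\colon\mathcal{S}\to\mathcal{L}$, and $W\in\mathbb{N}$; write $w_i=w(s_i)$. Consider the dynamic programming algorithm which, for $i\in\{0,\ldots,n\}$ and $x\in\{0,\ldots,W\}$, computes label sets $\mathcal{L}_{i,x}$ of rank cardinality vectors as follows: $\mathcal{L}_{0,x}=\{(0,\ldots,0)\}$ (the label of the empty item set) for all $x$; for $i=1,\ldots,n$ and $x=0,\ldots,W$, if $w_i>x$ then $\mathcal{L}_{i,x}=\mathcal{L}_{i-1,x}$, and otherwise $\mathcal{L}_{i,x}$ is the set of maximal (non-dominated) elements with respect to $\succeq$ of $\mathcal{L}_{i-1,x}\cup\{g+e_{r(s_i)} : g\in\mathcal{L}_{i-1,x-w_i}\}$, where $e_{r(s_i)}$ is the unit vector increasing the component of the level $r(s_i)$ by one; the algorithm returns $\mathcal{L}_{n,W}$. Then the returned set $\mathcal{L}_{n,W}$ is exactly the set of non-dominated rank cardinality vectors, i.e., $\{g(S^*): S^*\in\mathcal{S}(W) \text{ efficient}\}$.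
   Context: $\mathcal{S}(W)=\{S'\subseteq\mathcal{S}: w(S')\le W\}$, $w(S')=\sum_{s\in S'}w(s)$. For $S\subseteq\mathcal{S}$, $g_i(S)=|\{s\in S: r(s)=\ell_i\}|$ and $g(S)=(g_1(S),\ldots,g_k(S))^\top$ is its rank cardinality vector. A numerical representation with respect to $r$ is a function $v\colon\mathcal{L}\to\mathbb{Q}^+$ such that for all $s_1,s_2\in\mathcal{S}$: $r(s_1)\succ r(s_2)$ iff $v(r(s_1))>v(r(s_2))$, and $r(s_1)=r(s_2)$ iff $v(r(s_1))=v(r(s_2))$; $\mathcal{V}_r$ is the set of all such $v$. For a vector $g\in\mathbb{N}^k$ put $v(g)=\sum_{i=1}^k v(\ell_i)g_i$, and $v(S)=v(g(S))$. Weak dominance: $g\succeq g'$ (and $S_1\succeq S_2$ when $g(S_1)\succeq g(S_2)$) iff $v(g)\ge v(g')$ for all $v\in\mathcal{V}_r$; dominance $g\succ g'$ iff $g\succeq g'$ and $v^*(g)>v^*(g')$ for some $v^*\in\mathcal{V}_r$. A set $S^*\in\mathcal{S}(W)$ is efficient if there is no $S\in\mathcal{S}(W)$ with $S\succ S^*$; the non-dominated rank cardinality vectors are the vectors $g(S^*)$ of efficient $S^*$ (counted as vectors, equivalent solutions giving the same vector listed once). -}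

module Defs where

open import Data.Nat as ℕ using (ℕ; zero; suc; _∸_)
open import Data.Bool using (Bool; true; false; if_then_else_)
open import Data.Fin as Fin using (Fin; fromℕ; inject₁)
open import Data.Fin.Subset using (Subset; _∈_; _∩_; ∣_∣)
open import Data.Vec as Vec using (Vec; tabulate; replicate; zipWith; _[_]%=_; lookup)
open import Data.Rational as ℚ using (ℚ; Positive; _/_)
open import Data.Integer using (+_)
open import Data.Product using (Σ; _×_; ∃; ∃-syntax)
open import Data.Sum using (_⊎_)
open import Relation.Nullary using (¬_; Dec; yes; no)
open import Relation.Nullary.Decidable using (⌊_⌋)
open import Relation.Binary.PropositionalEquality using (_≡_)
open import Function.Bundles using (_⇔_)

-- Items are s_0 … s_(n-1) (Fin n); levels ℓ_1 ≺ … ≺ ℓ_k are Fin k ordered by Fin._<_.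
-- Rank cardinality vectors are Vec ℕ k.

RCV : ℕ → Set
RCV k = Vec ℕ k

weight : ∀ {n} → (Fin n → ℕ) → Subset n → ℕ
weight w S = Vec.sum (zipWith (λ b x → if b then x else 0) S (tabulate w))

levelSet : ∀ {n k} → (Fin n → Fin k) → Fin k → Subset n
levelSet r i = tabulate (λ j → ⌊ r j Fin.≟ i ⌋)

rcv : ∀ {n k} → (Fin n → Fin k) → Subset n → RCV k
rcv r S = tabulate (λ i → ∣ S ∩ levelSet r i ∣)

IsNumRep : ∀ {n k} → (Fin n → Fin k) → (Fin k → ℚ) → Set
IsNumRep {n} r v =
  (∀ l → Positive (v l)) ×
  (∀ (s₁ s₂ : Fin n) →
     ((r s₂ Fin.< r s₁) ⇔ (v (r s₂) ℚ.< v (r s₁))) ×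
     ((r s₁ ≡ r s₂) ⇔ (v (r s₁) ≡ v (r s₂))))

value : ∀ {k} → (Fin k → ℚ) → RCV k → ℚ
value {k} v g = Vec.foldr _ ℚ._+_ ℚ.0ℚ (tabulate (λ i → v i ℚ.* ((+ lookup g i) / 1)))

WeakDom : ∀ {n k} → (Fin n → Fin k) → RCV k → RCV k → Set
WeakDom r g g' = ∀ v → IsNumRep r v → value v g' ℚ.≤ value v g

Dom : ∀ {n k} → (Fin n → Fin k) → RCV k → RCV k → Set
Dom r g g' = WeakDom r g g' × ∃[ v ] (IsNumRep r v × value v g' ℚ.< value v g)

Efficient : ∀ {n k} → (Fin n → ℕ) → (Fin n → Fin k) → ℕ → Subset n → Set
Efficient {n} w r W S* =
  weight w S* ℕ.≤ W × ¬ (Σ (Subset n) λ S → weight w S ℕ.≤ W × Dom r (rcv r S) (rcv r S*))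

Maximal : ∀ {n k} → (Fin n → Fin k) → (RCV k → Set) → RCV k → Set
Maximal {k = k} r U g = U g × ¬ (Σ (RCV k) λ h → U h × Dom r h g)

addUnit : ∀ {k} → RCV k → Fin k → RCV k
addUnit g l = g [ l ]%= suc

-- Dynamic programme: Label m w r x g  means  g ∈ 𝓛_{m,x}, computed for the first
-- m items (item i of the paper is Fin index i-1; item m is 'fromℕ m' in Fin (suc m),
-- the earlier items are reached by inject₁).  The dominance relation ≻ is taken
-- with respect to the full rank function rN of all n items.
Label : ∀ {n k} → (Fin n → Fin k) → (m : ℕ) → (Fin m → ℕ) → (Fin m → Fin k) →
        ℕ → RCV k → Set
Label {k = k} rN zero w r x g = g ≡ replicate k 0
Label {k = k} rN (suc m) w r x g =
  (ℕ._<_ x wi × Label rN m w′ r′ x g) ⊎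
  (wi ℕ.≤ x × Maximal rN U g)
  where
  wi = w (fromℕ m)
  w′ : Fin m → ℕ
  w′ j = w (inject₁ j)
  r′ : Fin m → Fin k
  r′ j = r (inject₁ j)
  U : RCV k → Set
  U h = Label rN m w′ r′ x h ⊎
        (Σ (RCV k) λ g′ → Label rN m w′ r′ (x ∸ wi) g′ × h ≡ addUnit g′ (r (fromℕ m)))

module Submission where

-- Call a vector feasible (for the first m items and capacity x) if it is the rank
-- cardinality vector g(S) of an item set S of weight at most x.  The invariant of
-- the programme (label-correct) is that the label set 𝓛_{m,x} consists exactly of
-- the maximal feasible vectors with respect to dominance ≻.  It is proved by
-- induction on m from three general facts:
--   * ≻ is a strict partial order invariant under g ↦ g + e_l, since every value
--     function v(g) = Σ v(ℓ_i) g_i is additive (value-addUnit, module Dominance);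
--   * in a finite search space every element lies weakly below a maximal one
--     (StrictOrder.undominated-above, applied to all item sets in feasible-covered);
--   * principle of optimality: the maximal elements of C = P ∪ (Q + e_l) are the
--     maximal elements of Max P ∪ (Max Q + e_l) (Dominance.Union.maximal-union).
-- Feasible sets for m+1 items are those for m items together with those taking the
-- last item (module LastItem), which is the recursion of the programme.  Finally
-- maximal feasible vectors are exactly the vectors of efficient sets.

open import Defs
open import Data.Nat using (ℕ)
open import Data.Fin using (Fin)
open import Data.Fin.Subset using (Subset)
open import Data.Product using (Σ; _×_)
open import Relation.Binary.PropositionalEquality using (_≡_)
open import Function.Bundles using (_⇔_)

open import Data.Nat using (zero; suc; _+_; _∸_; _≤_; _<_; z≤n)
import Data.Nat.Properties as ℕP
import Data.Integer as ℤ
import Data.Integer.Properties as ℤP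
open import Data.Rational as ℚ using (ℚ; toℚᵘ; fromℚᵘ)
import Data.Rational.Properties as ℚP
open import Data.Rational.Unnormalised as ℚᵘ using (mkℚᵘ; *≡*)
import Data.Rational.Unnormalised.Properties as ℚᵘP
open import Data.Rational.Solver using (module +-*-Solver)
open import Data.Bool using (Bool; true; false; if_then_else_; _∧_)
open import Data.Fin as Fin using (fromℕ; inject₁)
open import Data.Fin.Subset using (_∩_; ∣_∣)
open import Data.Vec as Vec using (Vec; []; _∷_; _∷ʳ_; tabulate; zipWith; replicate)
import Data.Vec.Properties as VecP
open import Data.List as List using (List)
open import Data.List.Membership.Propositional using (_∈_)
open import Data.List.Membership.Propositional.Properties using (∈-map⁺; ∈-++⁺ˡ; ∈-++⁺ʳ)
open import Data.List.Relation.Unary.Any using (here; there)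
open import Data.Product using (_,_; proj₁; proj₂)
open import Data.Sum as Sum using (_⊎_; inj₁; inj₂)
open import Data.Empty using (⊥-elim)
open import Function using (_∘_; id)
open import Function.Bundles using (mk⇔; Equivalence)
open import Function.Properties.Equivalence using () renaming (trans to ⇔-trans; sym to ⇔-sym)
open import Relation.Nullary using (¬_; yes; no)
open import Relation.Nullary.Decidable using (⌊_⌋; ¬¬-excluded-middle)
open import Relation.Binary.Construct.Closure.Reflexive as Refl using (ReflClosure; [_])
open import Relation.Binary.PropositionalEquality using (refl; cong; cong₂; trans; sym; subst; subst₂; module ≡-Reasoning)

-- Cross-multiplication identity behind m/1 + n/1 = (m + n)/1 in unnormalised ℚ.
cross-multiplied : ∀ m n → ℤ.+ (m + n) ℤ.* ℤ.+ 1 ≡ (ℤ.+ m ℤ.* ℤ.+ 1 ℤ.+ ℤ.+ n ℤ.* ℤ.+ 1) ℤ.* ℤ.+ 1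
cross-multiplied m n = begin
  ℤ.+ (m + n) ℤ.* ℤ.+ 1                         ≡⟨ ℤP.*-identityʳ (ℤ.+ (m + n)) ⟩
  ℤ.+ m ℤ.+ ℤ.+ n                               ≡⟨ cong₂ ℤ._+_ (sym (ℤP.*-identityʳ (ℤ.+ m)))
                                                                (sym (ℤP.*-identityʳ (ℤ.+ n))) ⟩
  ℤ.+ m ℤ.* ℤ.+ 1 ℤ.+ ℤ.+ n ℤ.* ℤ.+ 1           ≡⟨ sym (ℤP.*-identityʳ _) ⟩
  (ℤ.+ m ℤ.* ℤ.+ 1 ℤ.+ ℤ.+ n ℤ.* ℤ.+ 1) ℤ.* ℤ.+ 1 ∎
  where open ≡-Reasoning

-- The embedding n ↦ n/1 of ℕ into ℚ is additive.  By definition (ℤ.+ n) ℚ./ 1 is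
-- fromℚᵘ (mkℚᵘ (ℤ.+ n) 0), so the identity is checked in unnormalised ℚ.
ℕ/1-+ : ∀ m n → (ℤ.+ (m + n)) ℚ./ 1 ≡ (ℤ.+ m) ℚ./ 1 ℚ.+ (ℤ.+ n) ℚ./ 1
ℕ/1-+ m n = ℚP.toℚᵘ-injective (begin
  toℚᵘ (n/1 (m + n))                 ≈⟨ back (m + n) ⟨
  ⟪ m + n ⟫                          ≈⟨ *≡* (cross-multiplied m n) ⟩
  ⟪ m ⟫ ℚᵘ.+ ⟪ n ⟫                    ≈⟨ ℚᵘP.+-cong (back m) (back n) ⟩
  toℚᵘ (n/1 m) ℚᵘ.+ toℚᵘ (n/1 n)      ≈⟨ ℚP.toℚᵘ-homo-+ (n/1 m) (n/1 n) ⟨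
  toℚᵘ (n/1 m ℚ.+ n/1 n)             ∎)
  where
  open ℚᵘP.≃-Reasoning
  ⟪_⟫ : ℕ → ℚᵘ.ℚᵘ
  ⟪ a ⟫ = mkℚᵘ (ℤ.+ a) 0
  n/1 : ℕ → ℚ
  n/1 a = (ℤ.+ a) ℚ./ 1
  back : ∀ a → ⟪ a ⟫ ℚᵘ.≃ toℚᵘ (n/1 a)
  back a = ℚᵘP.≃-sym (ℚP.toℚᵘ-fromℚᵘ ⟪ a ⟫)

value-addUnit : ∀ {k} (v : Fin k → ℚ) (g : RCV k) l → value v (addUnit g l) ≡ value v g ℚ.+ v l
value-addUnit v (a ∷ g) Fin.zero = begin
  v₀ ℚ.* ((ℤ.+ suc a) ℚ./ 1) ℚ.+ rest      ≡⟨ cong (λ t → v₀ ℚ.* t ℚ.+ rest) (ℕ/1-+ 1 a) ⟩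
  v₀ ℚ.* (ℚ.1ℚ ℚ.+ a/1) ℚ.+ rest           ≡⟨ +-*-Solver.solve 3
                                                 (λ u x R → u :* (con ℚ.1ℚ :+ x) :+ R := (u :* x :+ R) :+ u)
                                                 refl v₀ a/1 rest ⟩
  (v₀ ℚ.* a/1 ℚ.+ rest) ℚ.+ v₀             ∎
  where
  open ≡-Reasoning
  open +-*-Solver using (_:*_; _:+_; _:=_; con)
  v₀ = v Fin.zero
  a/1 = (ℤ.+ a) ℚ./ 1
  rest = value (v ∘ Fin.suc) g
value-addUnit v (a ∷ g) (Fin.suc l) = begin
  head ℚ.+ value (v ∘ Fin.suc) (addUnit g l)    ≡⟨ cong (head ℚ.+_) (value-addUnit (v ∘ Fin.suc) g l) ⟩
  head ℚ.+ (value (v ∘ Fin.suc) g ℚ.+ v (Fin.suc l)) ≡⟨ sym (ℚP.+-assoc head _ (v (Fin.suc l))) ⟩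
  head ℚ.+ value (v ∘ Fin.suc) g ℚ.+ v (Fin.suc l)   ∎
  where
  open ≡-Reasoning
  head = v Fin.zero ℚ.* ((ℤ.+ a) ℚ./ 1)

module Dominance {n k : ℕ} (r : Fin n → Fin k) where

  ≻-trans : ∀ {a b c} → Dom r a b → Dom r b c → Dom r a c
  ≻-trans (a⪰b , v , v-rep , b<a) (b⪰c , _) =
    (λ u u-rep → ℚP.≤-trans (b⪰c u u-rep) (a⪰b u u-rep)) ,
    v , v-rep , ℚP.≤-<-trans (b⪰c v v-rep) b<a

  ≻-irrefl : ∀ {a} → ¬ Dom r a a
  ≻-irrefl (_ , _ , _ , a<a) = ℚP.<-irrefl refl a<a

  -- Adding the same unit vector to both sides preserves dominance, because every
  -- value function shifts both values by the same amount v(ℓ_l).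
  ≻-addUnit : ∀ {a b} l → Dom r a b → Dom r (addUnit a l) (addUnit b l)
  ≻-addUnit {a} {b} l (a⪰b , v , v-rep , b<a) =
    (λ u u-rep → subst₂ ℚ._≤_ (sym (value-addUnit u b l)) (sym (value-addUnit u a l))
                   (ℚP.+-monoˡ-≤ (u l) (a⪰b u u-rep))) ,
    v , v-rep , subst₂ ℚ._<_ (sym (value-addUnit v b l)) (sym (value-addUnit v a l))
                  (ℚP.+-monoˡ-< (v l) b<a)

  _⪰_ : RCV k → RCV k → Set
  _⪰_ = ReflClosure (Dom r)

  -- Dominance is not decidable, so existence is only asserted under ¬¬; this
  -- suffices because covering is only used to refute dominance claims.
  Covered : (RCV k → Set) → Set
  Covered C = ∀ {h} → C h → ¬ ¬ Σ (RCV k) λ y → Maximal r C y × y ⪰ h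

  Maximal-cong : ∀ {P Q : RCV k → Set} → (∀ {h} → P h ⇔ Q h) → ∀ {g} → Maximal r P g ⇔ Maximal r Q g
  Maximal-cong P⇔Q = mk⇔ (transport (Equivalence.to P⇔Q) (Equivalence.from P⇔Q))
                         (transport (Equivalence.from P⇔Q) (Equivalence.to P⇔Q))
    where
    transport : ∀ {P Q : RCV k → Set} → (∀ {h} → P h → Q h) → (∀ {h} → Q h → P h) →
                ∀ {g} → Maximal r P g → Maximal r Q g
    transport P→Q Q→P (Pg , undominated) =
      P→Q Pg , λ (h , Qh , h≻g) → undominated (h , Q→P Qh , h≻g)

  Maximal-singleton : ∀ z {g} → Maximal r (_≡ z) g ⇔ g ≡ z
  Maximal-singleton z = mk⇔ proj₁ λ { refl → refl , λ { (h , refl , z≻z) → ≻-irrefl {z} z≻z } }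

  module Union {C P Q : RCV k → Set} (l : Fin k)
    (C⊆ : ∀ {h} → C h → P h ⊎ Σ (RCV k) λ b → Q b × h ≡ addUnit b l)
    (P⊆C : ∀ {h} → P h → C h)
    (Q⊆C : ∀ {b} → Q b → C (addUnit b l))
    (covered : Covered C) where

    Candidates : RCV k → Set
    Candidates h = Maximal r P h ⊎ Σ (RCV k) λ b → Maximal r Q b × h ≡ addUnit b l

    candidates⊆C : ∀ {h} → Candidates h → C h
    candidates⊆C (inj₁ (Ph , _)) = P⊆C Ph
    candidates⊆C (inj₂ (b , (Qb , _) , refl)) = Q⊆C Qb

    -- A maximal element of C is maximal in the part it comes from; for the shifted
    -- part this uses that ≻ is invariant under adding e_l.
    maximal⇒candidate : ∀ {g} → Maximal r C g → Candidates g
    maximal⇒candidate (Cg , undominated) with C⊆ Cg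
    ... | inj₁ Pg = inj₁ (Pg , λ (h , Ph , h≻g) → undominated (h , P⊆C Ph , h≻g))
    ... | inj₂ (b , Qb , refl) =
      inj₂ (b , (Qb , λ (h , Qh , h≻b) →
                   undominated (addUnit h l , Q⊆C Qh , ≻-addUnit {h} {b} l h≻b)) , refl)

    -- Conversely, if some h ∈ C dominated a maximal candidate g, so would a maximal
    -- element y ⪰ h of C, which is itself a candidate.
    maximal-union : ∀ {g} → Maximal r C g ⇔ Maximal r Candidates g
    maximal-union {g} = mk⇔
      (λ max@(_ , undominated) →
         maximal⇒candidate max , λ (h , cand , h≻g) → undominated (h , candidates⊆C cand , h≻g))
      (λ (cand , undominated) →
         candidates⊆C cand , λ (h , Ch , h≻g) → covered Ch λ where
           (y , maxy , Refl.refl) → undominated (y , maximal⇒candidate maxy , h≻g)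
           (y , maxy , [ y≻h ]) → undominated (y , maximal⇒candidate maxy , ≻-trans {y} {h} {g} y≻h h≻g))

module StrictOrder {X : Set} (_>_ : X → X → Set)
  (>-trans : ∀ {a b c} → a > b → b > c → a > c) (>-irrefl : ∀ {a} → ¬ a > a) where

  ≥->-trans : ∀ {a b c} → ReflClosure _>_ a b → b > c → a > c
  ≥->-trans Refl.refl b>c = b>c
  ≥->-trans [ a>b ] b>c = >-trans a>b b>c

  >-≥-trans : ∀ {a b c} → a > b → ReflClosure _>_ b c → a > c
  >-≥-trans a>b Refl.refl = a>b
  >-≥-trans a>b [ b>c ] = >-trans a>b b>c

  -- By induction on L: if the new head a exceeds the candidate y for the tail,
  -- switch to the candidate above a.  As _>_ need not be decidable, this case
  -- split uses excluded middle, which is available under the double negation.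
  undominated-above : ∀ (L : List X) x →
    ¬ ¬ Σ X λ y → ReflClosure _>_ y x × (∀ z → z ∈ L → ¬ z > y)
  undominated-above List.[] x k = k (x , Refl.refl , λ _ ())
  undominated-above (a List.∷ L) x k = undominated-above L x λ (y , y≥x , y-top) →
    ¬¬-excluded-middle λ where
      (no a≯y) → k (y , y≥x , λ { z (here refl) → a≯y ; z (there z∈L) → y-top z z∈L })
      (yes a>y) → undominated-above L a λ (y′ , y′≥a , y′-top) →
        k (y′ , [ ≥->-trans y′≥a (>-≥-trans a>y y≥x) ] ,
           λ { z (here refl) a>y′ → >-irrefl (>-≥-trans a>y′ y′≥a) ; z (there z∈L) → y′-top z z∈L })

allSubsets : ∀ m → List (Subset m)
allSubsets zero = List.[ [] ]
allSubsets (suc m) = List.map (true ∷_) (allSubsets m) List.++ List.map (false ∷_) (allSubsets m)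

allSubsets-complete : ∀ {m} (S : Subset m) → S ∈ allSubsets m
allSubsets-complete [] = here refl
allSubsets-complete (true ∷ S) = ∈-++⁺ˡ (∈-map⁺ (true ∷_) (allSubsets-complete S))
allSubsets-complete {suc m} (false ∷ S) =
  ∈-++⁺ʳ (List.map (true ∷_) (allSubsets m)) (∈-map⁺ (false ∷_) (allSubsets-complete S))

tabulate-∷ʳ : ∀ {A : Set} {m} (f : Fin (suc m) → A) →
              tabulate f ≡ tabulate (f ∘ inject₁) ∷ʳ f (fromℕ m)
tabulate-∷ʳ {m = zero} f = refl
tabulate-∷ʳ {m = suc m} f = cong (f Fin.zero ∷_) (tabulate-∷ʳ (f ∘ Fin.suc))

zipWith-∷ʳ : ∀ {A B C : Set} {m} (f : A → B → C) (xs : Vec A m) (ys : Vec B m) x y →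
             zipWith f (xs ∷ʳ x) (ys ∷ʳ y) ≡ zipWith f xs ys ∷ʳ f x y
zipWith-∷ʳ f [] [] x y = refl
zipWith-∷ʳ f (x′ ∷ xs) (y′ ∷ ys) x y = cong (f x′ y′ ∷_) (zipWith-∷ʳ f xs ys x y)

sum-∷ʳ : ∀ {m} (xs : Vec ℕ m) x → Vec.sum (xs ∷ʳ x) ≡ Vec.sum xs + x
sum-∷ʳ [] x = ℕP.+-identityʳ x
sum-∷ʳ (y ∷ xs) x = trans (cong (y +_) (sum-∷ʳ xs x)) (sym (ℕP.+-assoc y (Vec.sum xs) x))

indicator : Bool → ℕ
indicator b = if b then 1 else 0

size-∷ʳ : ∀ {m} (p : Subset m) b → ∣ p ∷ʳ b ∣ ≡ ∣ p ∣ + indicator b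
size-∷ʳ [] true = refl
size-∷ʳ [] false = refl
size-∷ʳ (true ∷ p) b = cong suc (size-∷ʳ p b)
size-∷ʳ (false ∷ p) b = size-∷ʳ p b

suc-≟-suc : ∀ {k} (l i : Fin k) → ⌊ Fin.suc l Fin.≟ Fin.suc i ⌋ ≡ ⌊ l Fin.≟ i ⌋
suc-≟-suc l i with l Fin.≟ i
... | yes _ = refl
... | no _ = refl

addUnit-tabulate : ∀ {k} (f : Fin k → ℕ) l →
                   addUnit (tabulate f) l ≡ tabulate (λ i → f i + indicator ⌊ l Fin.≟ i ⌋)
addUnit-tabulate f Fin.zero =
  cong₂ _∷_ (ℕP.+-comm 1 (f Fin.zero)) (sym (VecP.tabulate-cong (ℕP.+-identityʳ ∘ f ∘ Fin.suc)))
addUnit-tabulate {suc k} f (Fin.suc l) =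
  cong₂ _∷_ (sym (ℕP.+-identityʳ (f Fin.zero)))
    (trans (addUnit-tabulate (f ∘ Fin.suc) l)
           (VecP.tabulate-cong λ i → cong (λ b → f (Fin.suc i) + indicator b) (sym (suc-≟-suc l i))))

Feasible : ∀ {m k} → (Fin m → ℕ) → (Fin m → Fin k) → ℕ → RCV k → Set
Feasible {m} w r x g = Σ (Subset m) λ S → weight w S ≤ x × g ≡ rcv r S

feasible-empty : ∀ {k} (w : Fin 0 → ℕ) (r : Fin 0 → Fin k) x {h} →
                 h ≡ replicate k 0 ⇔ Feasible w r x h
feasible-empty {k} w r x =
  mk⇔ (λ { refl → [] , z≤n , sym zero-rcv }) (λ { ([] , _ , refl) → zero-rcv })
  where
  zero-rcv : rcv r [] ≡ replicate k 0
  zero-rcv = trans (VecP.tabulate-∘ (λ _ → 0) id) (VecP.map-const (tabulate id) 0)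

-- Every feasible vector lies weakly below a maximal feasible one: apply
-- undominated-above to the list of all item sets, ordered by Z > T iff Z is
-- feasible and g(Z) ≻ g(T).
feasible-covered : ∀ {n k m} (rN : Fin n → Fin k) (w : Fin m → ℕ) (r : Fin m → Fin k) x →
                   Dominance.Covered rN (Feasible w r x)
feasible-covered {m = m} rN w r x (S , S≤x , refl) k =
  undominated-above (allSubsets m) S λ (T , T≥S , T-top) →
    k (rcv r T ,
       (T-feasible T≥S ,
        λ { (h , (Z , Z≤x , refl) , h≻T) → T-top Z (allSubsets-complete Z) (Z≤x , h≻T) }) ,
       Refl.map {f = rcv r} proj₂ T≥S)
  where
  open Dominance rN using (≻-trans; ≻-irrefl)
  _>_ : Subset m → Subset m → Set
  Z > T = weight w Z ≤ x × Dom rN (rcv r Z) (rcv r T)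
  >-trans : ∀ {a b c} → a > b → b > c → a > c
  >-trans {a} {b} {c} (a≤x , a≻b) (_ , b≻c) = a≤x , ≻-trans {rcv r a} {rcv r b} {rcv r c} a≻b b≻c
  >-irrefl : ∀ {a} → ¬ a > a
  >-irrefl {a} (_ , a≻a) = ≻-irrefl {rcv r a} a≻a
  -- _>_ is not injective in its arguments, so the implicit ones are passed on explicitly.
  open StrictOrder _>_ (λ {a} {b} {c} → >-trans {a} {b} {c}) (λ {a} → >-irrefl {a})
    using (undominated-above)
  T-feasible : ∀ {T} → ReflClosure _>_ T S → Feasible w r x (rcv r T)
  T-feasible Refl.refl = S , S≤x , refl
  T-feasible {T} [ T≤x , _ ] = T , T≤x , refl

module LastItem {m k : ℕ} (w : Fin (suc m) → ℕ) (r : Fin (suc m) → Fin k) where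
  w′ : Fin m → ℕ
  w′ = w ∘ inject₁
  r′ : Fin m → Fin k
  r′ = r ∘ inject₁
  wₘ : ℕ
  wₘ = w (fromℕ m)
  ρ : Fin k
  ρ = r (fromℕ m)

  weight-∷ʳ : ∀ T b → weight w (T ∷ʳ b) ≡ weight w′ T + (if b then wₘ else 0)
  weight-∷ʳ T b = begin
    Vec.sum (zipWith sel (T ∷ʳ b) (tabulate w))          ≡⟨ cong (Vec.sum ∘ zipWith sel (T ∷ʳ b)) (tabulate-∷ʳ w) ⟩
    Vec.sum (zipWith sel (T ∷ʳ b) (tabulate w′ ∷ʳ wₘ))   ≡⟨ cong Vec.sum (zipWith-∷ʳ sel T (tabulate w′) b wₘ) ⟩
    Vec.sum (zipWith sel T (tabulate w′) ∷ʳ sel b wₘ)    ≡⟨ sum-∷ʳ (zipWith sel T (tabulate w′)) (sel b wₘ) ⟩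
    weight w′ T + sel b wₘ                               ∎
    where
    open ≡-Reasoning
    sel : Bool → ℕ → ℕ
    sel b x = if b then x else 0

  level-size-∷ʳ : ∀ T b i →
    ∣ (T ∷ʳ b) ∩ levelSet r i ∣ ≡ ∣ T ∩ levelSet r′ i ∣ + indicator (b ∧ ⌊ ρ Fin.≟ i ⌋)
  level-size-∷ʳ T b i = begin
    ∣ (T ∷ʳ b) ∩ levelSet r i ∣               ≡⟨ cong (λ L → ∣ (T ∷ʳ b) ∩ L ∣) split-level ⟩
    ∣ (T ∷ʳ b) ∩ (levelSet r′ i ∷ʳ d) ∣       ≡⟨ cong ∣_∣ (zipWith-∷ʳ _∧_ T (levelSet r′ i) b d) ⟩
    ∣ (T ∩ levelSet r′ i) ∷ʳ (b ∧ d) ∣         ≡⟨ size-∷ʳ (T ∩ levelSet r′ i) (b ∧ d) ⟩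
    ∣ T ∩ levelSet r′ i ∣ + indicator (b ∧ d) ∎
    where
    open ≡-Reasoning
    d = ⌊ ρ Fin.≟ i ⌋
    split-level : levelSet r i ≡ levelSet r′ i ∷ʳ d
    split-level = tabulate-∷ʳ (λ j → ⌊ r j Fin.≟ i ⌋)

  rcv-∷ʳ-false : ∀ T → rcv r (T ∷ʳ false) ≡ rcv r′ T
  rcv-∷ʳ-false T = VecP.tabulate-cong λ i → trans (level-size-∷ʳ T false i) (ℕP.+-identityʳ _)

  rcv-∷ʳ-true : ∀ T → rcv r (T ∷ʳ true) ≡ addUnit (rcv r′ T) ρ
  rcv-∷ʳ-true T = trans (VecP.tabulate-cong (level-size-∷ʳ T true))
                        (sym (addUnit-tabulate (λ i → ∣ T ∩ levelSet r′ i ∣) ρ))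

  feasible-split : ∀ {x h} → Feasible w r x h →
    Feasible w′ r′ x h ⊎ (wₘ ≤ x × Σ (RCV k) λ b → Feasible w′ r′ (x ∸ wₘ) b × h ≡ addUnit b ρ)
  feasible-split {x} (S , S≤x , refl) with Vec.initLast S
  ... | T , false , refl =
    inj₁ (T , subst (_≤ x) (trans (weight-∷ʳ T false) (ℕP.+-identityʳ _)) S≤x , rcv-∷ʳ-false T)
  ... | T , true , refl =
    let T+wₘ≤x = subst (_≤ x) (weight-∷ʳ T true) S≤x in
    inj₂ (ℕP.m+n≤o⇒n≤o (weight w′ T) T+wₘ≤x , rcv r′ T ,
          (T , ℕP.m+n≤o⇒m≤o∸n (weight w′ T) T+wₘ≤x , refl) , rcv-∷ʳ-true T)

  feasible-skip : ∀ {x h} → Feasible w′ r′ x h → Feasible w r x h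
  feasible-skip {x} (T , T≤x , refl) =
    T ∷ʳ false , subst (_≤ x) (sym (trans (weight-∷ʳ T false) (ℕP.+-identityʳ _))) T≤x ,
    sym (rcv-∷ʳ-false T)

  feasible-take : ∀ {x b} → wₘ ≤ x → Feasible w′ r′ (x ∸ wₘ) b → Feasible w r x (addUnit b ρ)
  feasible-take {x} wₘ≤x (T , T≤x∸wₘ , refl) =
    T ∷ʳ true ,
    subst (_≤ x) (sym (weight-∷ʳ T true))
      (subst (weight w′ T + wₘ ≤_) (ℕP.m∸n+n≡m wₘ≤x) (ℕP.+-monoˡ-≤ wₘ T≤x∸wₘ)) ,
    sym (rcv-∷ʳ-true T)

  feasible-heavy : ∀ {x h} → x < wₘ → Feasible w r x h ⇔ Feasible w′ r′ x h
  feasible-heavy {x} x<wₘ = mk⇔ skipped feasible-skip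
    where
    skipped : ∀ {h} → Feasible w r x h → Feasible w′ r′ x h
    skipped Fh with feasible-split Fh
    ... | inj₁ F′h = F′h
    ... | inj₂ (wₘ≤x , _) = ⊥-elim (ℕP.<⇒≱ x<wₘ wₘ≤x)

label-correct : ∀ {n k} (rN : Fin n → Fin k) m (w : Fin m → ℕ) (r : Fin m → Fin k) x {g} →
                Label rN m w r x g ⇔ Maximal rN (Feasible w r x) g
label-correct {k = k} rN zero w r x =
  ⇔-trans (⇔-sym (Maximal-singleton (replicate k 0))) (Maximal-cong (feasible-empty w r x))
  where open Dominance rN
label-correct {k = k} rN (suc m) w r x {g} = mk⇔ to from
  where
  open Dominance rN
  open LastItem w r

  IH : ∀ x {g} → Label rN m w′ r′ x g ⇔ Maximal rN (Feasible w′ r′ x) g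
  IH = label-correct rN m w′ r′

  module Step (wₘ≤x : wₘ ≤ x) =
    Union ρ (Sum.map₂ proj₂ ∘ feasible-split) feasible-skip (feasible-take wₘ≤x)
          (feasible-covered rN w r x)

  heavy : x < wₘ → Label rN m w′ r′ x g ⇔ Maximal rN (Feasible w r x) g
  heavy x<wₘ = ⇔-trans (IH x) (Maximal-cong (⇔-sym (feasible-heavy x<wₘ)))

  -- Light last item: by induction the set combined in the programme is
  -- Max P ∪ (Max Q + e_ρ), whose maximal elements are given by maximal-union.
  light : (wₘ≤x : wₘ ≤ x) →
    Maximal rN (λ h → Label rN m w′ r′ x h ⊎
                      Σ (RCV k) λ b → Label rN m w′ r′ (x ∸ wₘ) b × h ≡ addUnit b ρ) g
      ⇔ Maximal rN (Feasible w r x) g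
  light wₘ≤x = ⇔-trans (Maximal-cong candidates) (⇔-sym (Step.maximal-union wₘ≤x))
    where
    candidates : ∀ {h} → (Label rN m w′ r′ x h ⊎
                          Σ (RCV k) λ b → Label rN m w′ r′ (x ∸ wₘ) b × h ≡ addUnit b ρ)
                         ⇔ Step.Candidates wₘ≤x h
    candidates = mk⇔
      (Sum.map (Equivalence.to (IH x)) λ (b , lb , eq) → b , Equivalence.to (IH (x ∸ wₘ)) lb , eq)
      (Sum.map (Equivalence.from (IH x)) λ (b , mb , eq) → b , Equivalence.from (IH (x ∸ wₘ)) mb , eq)

  to : Label rN (suc m) w r x g → Maximal rN (Feasible w r x) g
  to (inj₁ (x<wₘ , lbl)) = Equivalence.to (heavy x<wₘ) lbl
  to (inj₂ (wₘ≤x , max)) = Equivalence.to (light wₘ≤x) max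

  from : Maximal rN (Feasible w r x) g → Label rN (suc m) w r x g
  from max with wₘ ℕP.≤? x
  ... | yes wₘ≤x = inj₂ (wₘ≤x , Equivalence.from (light wₘ≤x) max)
  ... | no wₘ≰x = inj₁ (ℕP.≰⇒> wₘ≰x , Equivalence.from (heavy (ℕP.≰⇒> wₘ≰x)) max)

maximal⇔efficient : ∀ {n k} (w : Fin n → ℕ) (r : Fin n → Fin k) W {g} →
  Maximal r (Feasible w r W) g ⇔ Σ (Subset n) (λ S → Efficient w r W S × g ≡ rcv r S)
maximal⇔efficient w r W = mk⇔
  (λ { ((S , S≤W , refl) , undominated) →
       S , (S≤W , λ (S′ , S′≤W , S′≻S) → undominated (rcv r S′ , (S′ , S′≤W , refl) , S′≻S)) , refl })
  (λ { (S , (S≤W , undominated) , refl) →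
       (S , S≤W , refl) , λ { (h , (S′ , S′≤W , refl) , h≻g) → undominated (S′ , S′≤W , h≻g) } })

mainTheorem6 : (n k : ℕ) (w : Fin n → ℕ) (r : Fin n → Fin k) (W : ℕ) (g : RCV k) →
    Label r n w r W g ⇔ Σ (Subset n) (λ S → Efficient w r W S × g ≡ rcv r S)
mainTheorem6 n k w r W g = ⇔-trans (label-correct r n w r W) (maximal⇔efficient w r W)
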